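{- Let $V$ be a word with $u$ letters $\uparrow$ and $d$ letters $\downarrow$, and let $H$ be a word with $r$ letters $\rightarrow$ and $l$ letters $\leftarrow$. Then the number of shuffles of $V$ and $H$ with even peak-count minus the number with odd peak-count is $$\sum_k (-1)^k\binom{r+u}{u-k}\binom{l+d}{d+k}.$$
   Context: A shuffle of $V$ and $H$ is a word obtained by interleaving the letters of $V$ and $H$, preserving the order of letters within $V$ and within $H$ (distinct interleavings counted separately). The peak-count of a shuffle $\sigma$ is the number of occurrences of $\uparrow$ immediately followed by $\leftarrow$ plus the number of occurrences of $\rightarrow$ immediately followed by $\downarrow$ in $\sigma$. Binomial coefficients $\binom{a}{b}$ are $0$ unless $0\le b\le a$; the sum runs over all integers $k$. -}

module Defs where

open import Data.Nat as ℕ using (ℕ; zero; suc)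
open import Data.Nat.Combinatorics using (_C_)
open import Data.Integer as ℤ using (ℤ; +_; -[1+_]; _-_; _+_; _*_; -_)
open import Data.List using (List; []; _∷_; map; _++_; length; filter; sum)
open import Data.Bool using (Bool; true; false; if_then_else_)
open import Relation.Nullary using (Dec; yes; no)

data Letter : Set where
  up down right left : Letter

data VLetter : Set where
  vup vdown : VLetter

data HLetter : Set where
  hright hleft : HLetter

vl : VLetter → Letter
vl vup = up
vl vdown = down

hl : HLetter → Letter
hl hright = right
hl hleft = left

-- All interleavings of two words, as a list with multiplicity
-- (distinct interleavings counted separately, even if they yield equal words).
shuffles : List Letter → List Letter → List (List Letter)
shuffles [] ys = ys ∷ []
shuffles (x ∷ xs) [] = (x ∷ xs) ∷ []
shuffles (x ∷ xs) (y ∷ ys) =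
  map (x ∷_) (shuffles xs (y ∷ ys)) ++ map (y ∷_) (shuffles (x ∷ xs) ys)

isPeak : Letter → Letter → Bool
isPeak up left = true
isPeak right down = true
isPeak _ _ = false

peakCount : List Letter → ℕ
peakCount [] = 0
peakCount (a ∷ []) = 0
peakCount (a ∷ b ∷ w) = (if isPeak a b then 1 else 0) ℕ.+ peakCount (b ∷ w)

even : ℕ → Bool
even zero = true
even (suc n) = not' (even n)
  where
  not' : Bool → Bool
  not' true = false
  not' false = true

signedCount : List (List Letter) → ℤ
signedCount [] = + 0
signedCount (w ∷ ws) = (if even (peakCount w) then + 1 else - (+ 1)) + signedCount ws

countV : VLetter → List VLetter → ℕ
countV c [] = 0
countV vup (vup ∷ w) = suc (countV vup w)
countV vdown (vdown ∷ w) = suc (countV vdown w)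
countV vup (vdown ∷ w) = countV vup w
countV vdown (vup ∷ w) = countV vdown w

countH : HLetter → List HLetter → ℕ
countH c [] = 0
countH hright (hright ∷ w) = suc (countH hright w)
countH hleft (hleft ∷ w) = suc (countH hleft w)
countH hright (hleft ∷ w) = countH hright w
countH hleft (hright ∷ w) = countH hleft w

-- integer-indexed binomial: binom a b = a C b if 0 ≤ b, and 0 if b < 0
-- (ℕ's _C_ already gives 0 when b > a)
binomℤ : ℕ → ℤ → ℤ
binomℤ a (+ b) = + (a C b)
binomℤ a -[1+ b ] = + 0

signℤ : ℤ → ℤ
signℤ (+ n) = if even n then + 1 else - (+ 1)
signℤ -[1+ n ] = if even n then - (+ 1) else + 1

symSum : ℕ → (ℤ → ℤ) → ℤ
symSum zero f = f (+ 0)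
symSum (suc n) f = f (+ suc n) + f -[1+ n ] + symSum n f

-- Σ over all integers k of (-1)^k C(r+u, u-k) C(l+d, d+k).  All terms with
-- |k| > u + d + r + l vanish, so the sum over k ∈ [-N, N] with
-- N = u + d + r + l equals the full sum over ℤ.
rhs : ℕ → ℕ → ℕ → ℕ → ℤ
rhs u d r l = symSum (u ℕ.+ d ℕ.+ r ℕ.+ l) λ k →
  signℤ k * binomℤ (r ℕ.+ u) (+ u - k) * binomℤ (l ℕ.+ d) (+ d + k)

module Submission where

-- Write F V H for the signed count of the shuffles of V and H, and
-- R V H for the binomial sum of the statement evaluated at the letter counts.
-- Both satisfy the same recursion on the first letters a of V and b of H:
--
--   X (a ∷ V) (b ∷ H) = X V (b ∷ H) + X (a ∷ V) H  - [a,b cross] · 2 · X V H,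
--
-- where a and b "cross" when they form a peak if written next to each other
-- (↑ before ←, or → before ↓), and both equal 1 when V or H is empty.
--
-- Combinatorial side: a shuffle of a ∷ V and b ∷ H starts with a or with b.
-- Prepending a letter c to a word flips its sign iff c makes a peak with the
-- next letter; ↓ and ← never start a peak, and a ↑ (resp. →) in front only
-- flips the shuffles continuing with ← (resp. ↓), which gives the correction.
--
-- Binomial side: write conv P Q x y = Σ_k (-1)^k C(P, x-k) C(Q, y+k).  Pascal's
-- rule in P and in Q, and the shift k ↦ k+1, which shows that
-- conv P Q (x-1) y + conv P Q x (y-1) = 0, yield the same recursion.

open import Defs
open import Data.Bool using (Bool; true; false; _∨_)
open import Data.List using (List; []; _∷_; map; _++_)
open import Data.List.Properties using (map-++)
open import Data.Nat as ℕ using (ℕ; zero; suc; _≤_; _<_; _⊔_; _≤′_; ≤′-refl; ≤′-step; z≤n; s≤s)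
import Data.Nat.Properties as ℕP
open import Data.Nat.Combinatorics using (_C_; k>n⇒nCk≡0; nCk+nC[k+1]≡[n+1]C[k+1]; nCn≡1)
open import Data.Integer as ℤ using (ℤ; +_; -[1+_]; _-_; _+_; _*_; -_; _⊖_; sign)
import Data.Integer.Properties as ℤP
open import Data.Integer.Tactic.RingSolver using (solve-∀)
open import Data.Product using (_×_; _,_)
import Data.Sign as Sign
open import Relation.Binary.PropositionalEquality
open ≡-Reasoning

symSum-cong : ∀ N {f g : ℤ → ℤ} → (∀ k → f k ≡ g k) → symSum N f ≡ symSum N g
symSum-cong zero    f≗g = f≗g (+ 0)
symSum-cong (suc N) f≗g = cong₂ _+_ (cong₂ _+_ (f≗g _) (f≗g _)) (symSum-cong N f≗g)

symSum-+ : ∀ N (f g : ℤ → ℤ) → symSum N (λ k → f k + g k) ≡ symSum N f + symSum N g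
symSum-+ zero    f g = refl
symSum-+ (suc N) f g = begin
    f i + g i + (f j + g j) + symSum N (λ k → f k + g k)
  ≡⟨ cong (_+_ (f i + g i + (f j + g j))) (symSum-+ N f g) ⟩
    f i + g i + (f j + g j) + (symSum N f + symSum N g)
  ≡⟨ interchange (f i) (g i) (f j) (g j) (symSum N f) (symSum N g) ⟩
    f i + f j + symSum N f + (g i + g j + symSum N g)
  ∎
  where
  i = + suc N
  j = -[1+ N ]
  interchange : ∀ a b c d s t → a + b + (c + d) + (s + t) ≡ a + c + s + (b + d + t)
  interchange = solve-∀

symSum-neg : ∀ N (f : ℤ → ℤ) → symSum N (λ k → - f k) ≡ - symSum N f
symSum-neg zero    f = refl
symSum-neg (suc N) f = begin
    - f (+ suc N) + - f -[1+ N ] + symSum N (λ k → - f k)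
  ≡⟨ cong (_+_ (- f (+ suc N) + - f -[1+ N ])) (symSum-neg N f) ⟩
    - f (+ suc N) + - f -[1+ N ] + - symSum N f
  ≡⟨ neg-sum (f (+ suc N)) (f -[1+ N ]) (symSum N f) ⟩
    - (f (+ suc N) + f -[1+ N ] + symSum N f)
  ∎
  where
  neg-sum : ∀ a b s → - a + - b + - s ≡ - (a + b + s)
  neg-sum = solve-∀

symSum-shift : ∀ N (g : ℤ → ℤ) →
  symSum N (λ k → g (+ 1 + k)) ≡ symSum N g + g (+ suc N) - g (- + N)
symSum-shift zero    g = add-sub (g (+ 0)) (g (+ 1))
  where
  add-sub : ∀ a b → b ≡ a + b - a
  add-sub = solve-∀
symSum-shift (suc N) g = begin
    g (+ suc (suc N)) + g (+ 1 + -[1+ N ]) + symSum N (λ k → g (+ 1 + k))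
  ≡⟨ cong₂ (λ k s → g (+ suc (suc N)) + g k + s) (one-plus-negative N) (symSum-shift N g) ⟩
    g (+ suc (suc N)) + g (- + N) + (symSum N g + g (+ suc N) - g (- + N))
  ≡⟨ regroup (g (+ suc (suc N))) (g (- + N)) (g (+ suc N)) (g -[1+ N ]) (symSum N g) ⟩
    g (+ suc N) + g -[1+ N ] + symSum N g + g (+ suc (suc N)) - g -[1+ N ]
  ∎
  where
  one-plus-negative : ∀ n → + 1 + -[1+ n ] ≡ - + n
  one-plus-negative zero    = refl
  one-plus-negative (suc n) = refl
  regroup : ∀ a b c d s → a + b + (s + c - b) ≡ c + d + s + a - d
  regroup = solve-∀

symSum-shift-invariant : ∀ N (g : ℤ → ℤ) → g (+ suc N) ≡ + 0 → g (- + N) ≡ + 0 →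
  symSum N (λ k → g (+ 1 + k)) ≡ symSum N g
symSum-shift-invariant N g g-right g-left = begin
    symSum N (λ k → g (+ 1 + k))
  ≡⟨ symSum-shift N g ⟩
    symSum N g + g (+ suc N) - g (- + N)
  ≡⟨ cong₂ (λ a b → symSum N g + a - b) g-right g-left ⟩
    symSum N g + + 0 - + 0
  ≡⟨ ℤP.+-identityʳ (symSum N g + + 0) ⟩
    symSum N g + + 0
  ≡⟨ ℤP.+-identityʳ (symSum N g) ⟩
    symSum N g
  ∎

VanishesBeyond : ℕ → (ℤ → ℤ) → Set
VanishesBeyond M f = ∀ j → M ≤ j → f (+ suc j) ≡ + 0 × f -[1+ j ] ≡ + 0

symSum-extend : ∀ {M N} (f : ℤ → ℤ) → VanishesBeyond M f → M ≤ N → symSum N f ≡ symSum M f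
symSum-extend {M} f vanishes M≤N = widen (ℕP.≤⇒≤′ M≤N)
  where
  widen : ∀ {N} → M ≤′ N → symSum N f ≡ symSum M f
  widen ≤′-refl = refl
  widen (≤′-step {N} M≤′N) with vanishes N (ℕP.≤′⇒≤ M≤′N)
  ... | right-zero , left-zero = begin
      f (+ suc N) + f -[1+ N ] + symSum N f
    ≡⟨ cong₂ (λ a b → a + b + symSum N f) right-zero left-zero ⟩
      + 0 + symSum N f
    ≡⟨ ℤP.+-identityˡ (symSum N f) ⟩
      symSum N f
    ≡⟨ widen M≤′N ⟩
      symSum M f
    ∎

-- Binomial coefficients with an integer lower index

binomℤ-pascal : ∀ n z → binomℤ (suc n) z ≡ binomℤ n (z - + 1) + binomℤ n z
binomℤ-pascal n (+ zero)  = refl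
binomℤ-pascal n (+ suc j) = cong +_ (sym (nCk+nC[k+1]≡[n+1]C[k+1] n j))
binomℤ-pascal n -[1+ j ]  = refl

binomℤ-negative : ∀ n z → sign z ≡ Sign.- → binomℤ n z ≡ + 0
binomℤ-negative n (+ zero)  ()
binomℤ-negative n (+ suc j) ()
binomℤ-negative n -[1+ j ]  _ = refl

binomℤ-below : ∀ n {a b} → a < b → binomℤ n (a ⊖ b) ≡ + 0
binomℤ-below n a<b = binomℤ-negative n _ (ℤP.sign-⊖-< a<b)

binomℤ-above : ∀ n j → binomℤ n (+ (n ℕ.+ suc j)) ≡ + 0
binomℤ-above n j = cong +_ (k>n⇒nCk≡0 (ℕP.m<m+n n (s≤s z≤n)))

signℤ-suc : ∀ k → signℤ (+ 1 + k) ≡ - signℤ k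
signℤ-suc (+ n) with even n
... | true  = refl
... | false = refl
signℤ-suc -[1+ zero ] = refl
signℤ-suc -[1+ suc n ] with even n
... | true  = refl
... | false = refl

-- The signed convolution  conv N P Q x y = Σ_{|k| ≤ N} (-1)^k C(P, x-k) C(Q, y+k)

term : ℕ → ℕ → ℤ → ℤ → ℤ → ℤ
term P Q x y k = signℤ k * binomℤ P (x - k) * binomℤ Q (y + k)

conv : ℕ → ℕ → ℕ → ℤ → ℤ → ℤ
conv N P Q x y = symSum N (term P Q x y)

term-zeroˡ : ∀ P Q x y k → binomℤ P (x - k) ≡ + 0 → term P Q x y k ≡ + 0
term-zeroˡ P Q x y k C≡0 = begin
    signℤ k * binomℤ P (x - k) * binomℤ Q (y + k)
  ≡⟨ cong (λ c → signℤ k * c * binomℤ Q (y + k)) C≡0 ⟩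
    signℤ k * + 0 * binomℤ Q (y + k)
  ≡⟨ cong (_* binomℤ Q (y + k)) (ℤP.*-zeroʳ (signℤ k)) ⟩
    + 0
  ∎

term-zeroʳ : ∀ P Q x y k → binomℤ Q (y + k) ≡ + 0 → term P Q x y k ≡ + 0
term-zeroʳ P Q x y k C≡0 =
  trans (cong (signℤ k * binomℤ P (x - k) *_) C≡0) (ℤP.*-zeroʳ (signℤ k * binomℤ P (x - k)))

term-vanishes : ∀ P Q u d → VanishesBeyond (u ⊔ d) (term P Q (+ u) (+ d))
term-vanishes P Q u d j u⊔d≤j =
    term-zeroˡ P Q (+ u) (+ d) (+ suc j)
      (binomℤ-below P (s≤s (ℕP.≤-trans (ℕP.m≤m⊔n u d) u⊔d≤j)))
  , term-zeroʳ P Q (+ u) (+ d) -[1+ j ]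
      (binomℤ-below Q (s≤s (ℕP.≤-trans (ℕP.m≤n⊔m u d) u⊔d≤j)))

term-pascalˡ : ∀ P Q x y k → term (suc P) Q x y k ≡ term P Q (x - + 1) y k + term P Q x y k
term-pascalˡ P Q x y k = begin
    s * binomℤ (suc P) (x - k) * B
  ≡⟨ cong (λ c → s * c * B) (binomℤ-pascal P (x - k)) ⟩
    s * (binomℤ P (x - k - + 1) + binomℤ P (x - k)) * B
  ≡⟨ cong (λ z → s * (binomℤ P z + binomℤ P (x - k)) * B) (reorder x k) ⟩
    s * (binomℤ P (x - + 1 - k) + binomℤ P (x - k)) * B
  ≡⟨ distrib s (binomℤ P (x - + 1 - k)) (binomℤ P (x - k)) B ⟩
    term P Q (x - + 1) y k + term P Q x y k
  ∎
  where
  s = signℤ k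
  B = binomℤ Q (y + k)
  reorder : ∀ x k → x - k - + 1 ≡ x - + 1 - k
  reorder = solve-∀
  distrib : ∀ s a b c → s * (a + b) * c ≡ s * a * c + s * b * c
  distrib = solve-∀

term-pascalʳ : ∀ P Q x y k → term P (suc Q) x y k ≡ term P Q x (y - + 1) k + term P Q x y k
term-pascalʳ P Q x y k = begin
    s * A * binomℤ (suc Q) (y + k)
  ≡⟨ cong (s * A *_) (binomℤ-pascal Q (y + k)) ⟩
    s * A * (binomℤ Q (y + k - + 1) + binomℤ Q (y + k))
  ≡⟨ cong (λ z → s * A * (binomℤ Q z + binomℤ Q (y + k))) (reorder y k) ⟩
    s * A * (binomℤ Q (y - + 1 + k) + binomℤ Q (y + k))
  ≡⟨ distrib s A (binomℤ Q (y - + 1 + k)) (binomℤ Q (y + k)) ⟩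
    term P Q x (y - + 1) k + term P Q x y k
  ∎
  where
  s = signℤ k
  A = binomℤ P (x - k)
  reorder : ∀ y k → y + k - + 1 ≡ y - + 1 + k
  reorder = solve-∀
  distrib : ∀ s a b c → s * a * (b + c) ≡ s * a * b + s * a * c
  distrib = solve-∀

-- Moving one unit from x to y is the shift k ↦ k + 1, which flips the sign.
term-shift : ∀ P Q x y k → term P Q (x - + 1) y k ≡ - term P Q x (y - + 1) (+ 1 + k)
term-shift P Q x y k = begin
    signℤ k * binomℤ P (x - + 1 - k) * binomℤ Q (y + k)
  ≡⟨ cong₂ (λ p q → signℤ k * binomℤ P p * binomℤ Q q) (lower x k) (upper y k) ⟩
    signℤ k * A * B
  ≡⟨ double-negation (signℤ k) A B ⟩
    - ((- signℤ k) * A * B)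
  ≡⟨ cong (λ s → - (s * A * B)) (sym (signℤ-suc k)) ⟩
    - term P Q x (y - + 1) (+ 1 + k)
  ∎
  where
  A = binomℤ P (x - (+ 1 + k))
  B = binomℤ Q (y - + 1 + (+ 1 + k))
  lower : ∀ x k → x - + 1 - k ≡ x - (+ 1 + k)
  lower = solve-∀
  upper : ∀ y k → y + k ≡ y - + 1 + (+ 1 + k)
  upper = solve-∀
  double-negation : ∀ s a b → s * a * b ≡ - ((- s) * a * b)
  double-negation = solve-∀

conv-pascalˡ : ∀ N P Q x y → conv N (suc P) Q x y ≡ conv N P Q (x - + 1) y + conv N P Q x y
conv-pascalˡ N P Q x y =
  trans (symSum-cong N (term-pascalˡ P Q x y)) (symSum-+ N (term P Q (x - + 1) y) (term P Q x y))

conv-pascalʳ : ∀ N P Q x y → conv N P (suc Q) x y ≡ conv N P Q x (y - + 1) + conv N P Q x y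
conv-pascalʳ N P Q x y =
  trans (symSum-cong N (term-pascalʳ P Q x y)) (symSum-+ N (term P Q x (y - + 1)) (term P Q x y))

conv-antidiagonal : ∀ N P Q a b → a ≤ N → b ≤ N →
  conv N P Q (+ a - + 1) (+ b) + conv N P Q (+ a) (+ b - + 1) ≡ + 0
conv-antidiagonal N P Q a b a≤N b≤N = begin
    conv N P Q (+ a - + 1) (+ b) + symSum N g
  ≡⟨ cong (_+ symSum N g) shifted ⟩
    - symSum N g + symSum N g
  ≡⟨ ℤP.+-inverseˡ (symSum N g) ⟩
    + 0
  ∎
  where
  g = term P Q (+ a) (+ b - + 1)
  g-right : g (+ suc N) ≡ + 0
  g-right = term-zeroˡ P Q (+ a) (+ b - + 1) (+ suc N) (binomℤ-below P (s≤s a≤N))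
  g-left : g (- + N) ≡ + 0
  g-left = term-zeroʳ P Q (+ a) (+ b - + 1) (- + N)
    (trans (cong (binomℤ Q) (past-left (+ b) (+ N))) (binomℤ-below Q (s≤s b≤N)))
    where
    past-left : ∀ b n → b - + 1 + - n ≡ b - (+ 1 + n)
    past-left = solve-∀
  shifted : conv N P Q (+ a - + 1) (+ b) ≡ - symSum N g
  shifted = begin
      symSum N (term P Q (+ a - + 1) (+ b))
    ≡⟨ symSum-cong N (term-shift P Q (+ a) (+ b)) ⟩
      symSum N (λ k → - g (+ 1 + k))
    ≡⟨ symSum-neg N (λ k → g (+ 1 + k)) ⟩
      - symSum N (λ k → g (+ 1 + k))
    ≡⟨ cong -_ (symSum-shift-invariant N g g-right g-left) ⟩
      - symSum N g
    ∎

-- The crossing correction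

adjust : Bool → ℤ → ℤ → ℤ
adjust false s z = s
adjust true  s z = s - (z + z)

adjust-+ˡ : ∀ c x y z → adjust c x z + y ≡ adjust c (x + y) z
adjust-+ˡ false x y z = refl
adjust-+ˡ true  x y z = rearrange x y z
  where
  rearrange : ∀ x y z → x - (z + z) + y ≡ x + y - (z + z)
  rearrange = solve-∀

adjust-+ʳ : ∀ c x y z → x + adjust c y z ≡ adjust c (x + y) z
adjust-+ʳ false x y z = refl
adjust-+ʳ true  x y z = rearrange x y z
  where
  rearrange : ∀ x y z → x + (y - (z + z)) ≡ x + y - (z + z)
  rearrange = solve-∀

absorb : ∀ X Y Z W → W + Y ≡ + 0 → X + (Y + Z) ≡ adjust true (X + (W + Z)) W
absorb X Y Z W W+Y≡0 = begin
    X + (Y + Z)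
  ≡⟨ regroup X Y Z W ⟩
    X + (W + Z) - (W + W) + (W + Y)
  ≡⟨ cong (_+_ (X + (W + Z) - (W + W))) W+Y≡0 ⟩
    X + (W + Z) - (W + W) + + 0
  ≡⟨ ℤP.+-identityʳ _ ⟩
    X + (W + Z) - (W + W)
  ∎
  where
  regroup : ∀ X Y Z W → X + (Y + Z) ≡ X + (W + Z) - (W + W) + (W + Y)
  regroup = solve-∀

conv-cross-up : ∀ N P Q u d → u < N → d ≤ N →
  conv N (suc P) (suc Q) (+ suc u) (+ d)
    ≡ adjust true (conv N P (suc Q) (+ u) (+ d) + conv N (suc P) Q (+ suc u) (+ d))
                  (conv N P Q (+ u) (+ d))
conv-cross-up N P Q u d u<N d≤N = begin
    conv N (suc P) (suc Q) (+ suc u) (+ d)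
  ≡⟨ conv-pascalˡ N P (suc Q) (+ suc u) (+ d) ⟩
    X + conv N P (suc Q) (+ suc u) (+ d)
  ≡⟨ cong (_+_ X) (conv-pascalʳ N P Q (+ suc u) (+ d)) ⟩
    X + (Y + Z)
  ≡⟨ absorb X Y Z W (conv-antidiagonal N P Q (suc u) d u<N d≤N) ⟩
    adjust true (X + (W + Z)) W
  ≡⟨ cong (λ t → adjust true (X + t) W) (sym (conv-pascalˡ N P Q (+ suc u) (+ d))) ⟩
    adjust true (X + conv N (suc P) Q (+ suc u) (+ d)) W
  ∎
  where
  X = conv N P (suc Q) (+ u) (+ d)
  Y = conv N P Q (+ suc u) (+ d - + 1)
  Z = conv N P Q (+ suc u) (+ d)
  W = conv N P Q (+ u) (+ d)

conv-cross-down : ∀ N P Q u d → u ≤ N → d < N →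
  conv N (suc P) (suc Q) (+ u) (+ suc d)
    ≡ adjust true (conv N (suc P) Q (+ u) (+ d) + conv N P (suc Q) (+ u) (+ suc d))
                  (conv N P Q (+ u) (+ d))
conv-cross-down N P Q u d u≤N d<N = begin
    conv N (suc P) (suc Q) (+ u) (+ suc d)
  ≡⟨ conv-pascalʳ N (suc P) Q (+ u) (+ suc d) ⟩
    X + conv N (suc P) Q (+ u) (+ suc d)
  ≡⟨ cong (_+_ X) (conv-pascalˡ N P Q (+ u) (+ suc d)) ⟩
    X + (Y + Z)
  ≡⟨ absorb X Y Z W (trans (ℤP.+-comm W Y) (conv-antidiagonal N P Q u (suc d) u≤N d<N)) ⟩
    adjust true (X + (W + Z)) W
  ≡⟨ cong (λ t → adjust true (X + t) W) (sym (conv-pascalʳ N P Q (+ u) (+ suc d))) ⟩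
    adjust true (X + conv N P (suc Q) (+ u) (+ suc d)) W
  ∎
  where
  X = conv N (suc P) Q (+ u) (+ d)
  Y = conv N P Q (+ u - + 1) (+ suc d)
  Z = conv N P Q (+ u) (+ suc d)
  W = conv N P Q (+ u) (+ d)

rhs-as-conv : ∀ {N} u d r l → u ≤ N → d ≤ N → rhs u d r l ≡ conv N (r ℕ.+ u) (l ℕ.+ d) (+ u) (+ d)
rhs-as-conv {N} u d r l u≤N d≤N = begin
    symSum (u ℕ.+ d ℕ.+ r ℕ.+ l) f
  ≡⟨ symSum-extend f (term-vanishes (r ℕ.+ u) (l ℕ.+ d) u d) support≤window ⟩
    symSum (u ⊔ d) f
  ≡⟨ sym (symSum-extend f (term-vanishes (r ℕ.+ u) (l ℕ.+ d) u d) (ℕP.⊔-lub u≤N d≤N)) ⟩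
    symSum N f
  ∎
  where
  f = term (r ℕ.+ u) (l ℕ.+ d) (+ u) (+ d)
  support≤window : u ⊔ d ≤ u ℕ.+ d ℕ.+ r ℕ.+ l
  support≤window = ℕP.≤-trans (ℕP.m⊔n≤m+n u d)
    (ℕP.≤-trans (ℕP.m≤m+n (u ℕ.+ d) r) (ℕP.m≤m+n (u ℕ.+ d ℕ.+ r) l))

rhs-as-convᵘ : ∀ {N} u d r l → u < N → d ≤ N →
  rhs (suc u) d r l ≡ conv N (suc (r ℕ.+ u)) (l ℕ.+ d) (+ suc u) (+ d)
rhs-as-convᵘ {N} u d r l u<N d≤N =
  trans (rhs-as-conv (suc u) d r l u<N d≤N) (cong (λ P → conv N P (l ℕ.+ d) (+ suc u) (+ d)) (ℕP.+-suc r u))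

rhs-as-convᵈ : ∀ {N} u d r l → u ≤ N → d < N →
  rhs u (suc d) r l ≡ conv N (r ℕ.+ u) (suc (l ℕ.+ d)) (+ u) (+ suc d)
rhs-as-convᵈ {N} u d r l u≤N d<N =
  trans (rhs-as-conv u (suc d) r l u≤N d<N) (cong (λ Q → conv N (r ℕ.+ u) Q (+ u) (+ suc d)) (ℕP.+-suc l d))

-- A window wide enough for every sum in the recursion at (u, d).
module Window (u d : ℕ) where
  N : ℕ
  N = suc u ℕ.+ suc d
  u<N : u < N
  u<N = ℕP.m≤m+n (suc u) (suc d)
  d<N : d < N
  d<N = ℕP.m≤n+m (suc d) (suc u)
  u≤N : u ≤ N
  u≤N = ℕP.<⇒≤ u<N
  d≤N : d ≤ N
  d≤N = ℕP.<⇒≤ d<N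

rhs-without-vertical : ∀ r l → rhs 0 0 r l ≡ + 1
rhs-without-vertical r l = rhs-as-conv 0 0 r l (z≤n {0}) z≤n

-- Without horizontal letters only k = 0 contributes, namely C(u,u) C(d,d).
rhs-without-horizontal : ∀ u d → rhs u d 0 0 ≡ + 1
rhs-without-horizontal u d = begin
    symSum (u ℕ.+ d ℕ.+ 0 ℕ.+ 0) f
  ≡⟨ symSum-extend {0} {u ℕ.+ d ℕ.+ 0 ℕ.+ 0} f only-zero z≤n ⟩
    + 1 * binomℤ u (+ u + + 0) * binomℤ d (+ d + + 0)
  ≡⟨ cong₂ (λ p q → + 1 * binomℤ u p * binomℤ d q) (ℤP.+-identityʳ (+ u)) (ℤP.+-identityʳ (+ d)) ⟩
    + 1 * + (u C u) * + (d C d)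
  ≡⟨ cong₂ (λ p q → + 1 * + p * + q) (nCn≡1 u) (nCn≡1 d) ⟩
    + 1
  ∎
  where
  f = term u d (+ u) (+ d)
  only-zero : VanishesBeyond 0 f
  only-zero j _ = term-zeroʳ u d (+ u) (+ d) (+ suc j) (binomℤ-above d j)
                , term-zeroˡ u d (+ u) (+ d) -[1+ j ] (binomℤ-above u j)

rhs-up-right : ∀ u d r l → rhs (suc u) d (suc r) l ≡ rhs u d (suc r) l + rhs (suc u) d r l
rhs-up-right u d r l = begin
    rhs (suc u) d (suc r) l
  ≡⟨ rhs-as-convᵘ u d (suc r) l u<N d≤N ⟩
    conv N (suc (suc P)) Q (+ suc u) (+ d)
  ≡⟨ conv-pascalˡ N (suc P) Q (+ suc u) (+ d) ⟩
    conv N (suc P) Q (+ u) (+ d) + conv N (suc P) Q (+ suc u) (+ d)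
  ≡⟨ sym (cong₂ _+_ (rhs-as-conv u d (suc r) l u≤N d≤N) (rhs-as-convᵘ u d r l u<N d≤N)) ⟩
    rhs u d (suc r) l + rhs (suc u) d r l
  ∎
  where
  open Window u d
  P = r ℕ.+ u
  Q = l ℕ.+ d

rhs-down-left : ∀ u d r l → rhs u (suc d) r (suc l) ≡ rhs u d r (suc l) + rhs u (suc d) r l
rhs-down-left u d r l = begin
    rhs u (suc d) r (suc l)
  ≡⟨ rhs-as-convᵈ u d r (suc l) u≤N d<N ⟩
    conv N P (suc (suc Q)) (+ u) (+ suc d)
  ≡⟨ conv-pascalʳ N P (suc Q) (+ u) (+ suc d) ⟩
    conv N P (suc Q) (+ u) (+ d) + conv N P (suc Q) (+ u) (+ suc d)
  ≡⟨ sym (cong₂ _+_ (rhs-as-conv u d r (suc l) u≤N d≤N) (rhs-as-convᵈ u d r l u≤N d<N)) ⟩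
    rhs u d r (suc l) + rhs u (suc d) r l
  ∎
  where
  open Window u d
  P = r ℕ.+ u
  Q = l ℕ.+ d

rhs-up-left : ∀ u d r l → rhs (suc u) d r (suc l)
  ≡ adjust true (rhs u d r (suc l) + rhs (suc u) d r l) (rhs u d r l)
rhs-up-left u d r l = begin
    rhs (suc u) d r (suc l)
  ≡⟨ rhs-as-convᵘ u d r (suc l) u<N d≤N ⟩
    conv N (suc P) (suc Q) (+ suc u) (+ d)
  ≡⟨ conv-cross-up N P Q u d u<N d≤N ⟩
    adjust true (conv N P (suc Q) (+ u) (+ d) + conv N (suc P) Q (+ suc u) (+ d)) (conv N P Q (+ u) (+ d))
  ≡⟨ sym (cong₂ (adjust true)
       (cong₂ _+_ (rhs-as-conv u d r (suc l) u≤N d≤N) (rhs-as-convᵘ u d r l u<N d≤N))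
       (rhs-as-conv u d r l u≤N d≤N)) ⟩
    adjust true (rhs u d r (suc l) + rhs (suc u) d r l) (rhs u d r l)
  ∎
  where
  open Window u d
  P = r ℕ.+ u
  Q = l ℕ.+ d

rhs-down-right : ∀ u d r l → rhs u (suc d) (suc r) l
  ≡ adjust true (rhs u d (suc r) l + rhs u (suc d) r l) (rhs u d r l)
rhs-down-right u d r l = begin
    rhs u (suc d) (suc r) l
  ≡⟨ rhs-as-convᵈ u d (suc r) l u≤N d<N ⟩
    conv N (suc P) (suc Q) (+ u) (+ suc d)
  ≡⟨ conv-cross-down N P Q u d u≤N d<N ⟩
    adjust true (conv N (suc P) Q (+ u) (+ d) + conv N P (suc Q) (+ u) (+ suc d)) (conv N P Q (+ u) (+ d))
  ≡⟨ sym (cong₂ (adjust true)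
       (cong₂ _+_ (rhs-as-conv u d (suc r) l u≤N d≤N) (rhs-as-convᵈ u d r l u≤N d<N))
       (rhs-as-conv u d r l u≤N d≤N)) ⟩
    adjust true (rhs u d (suc r) l + rhs u (suc d) r l) (rhs u d r l)
  ∎
  where
  open Window u d
  P = r ℕ.+ u
  Q = l ℕ.+ d

-- Signs of words and of lists of words

wordSign : List Letter → ℤ
wordSign w = signℤ (+ peakCount w)

signedCount-++ : ∀ xs ys → signedCount (xs ++ ys) ≡ signedCount xs + signedCount ys
signedCount-++ []       ys = sym (ℤP.+-identityˡ (signedCount ys))
signedCount-++ (w ∷ xs) ys =
  trans (cong (_+_ (wordSign w)) (signedCount-++ xs ys))
        (sym (ℤP.+-assoc (wordSign w) (signedCount xs) (signedCount ys)))

flipIf : Bool → ℤ → ℤ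
flipIf true  z = - z
flipIf false z = z

flipIf-+ : ∀ c x y → flipIf c (x + y) ≡ flipIf c x + flipIf c y
flipIf-+ true  x y = ℤP.neg-distrib-+ x y
flipIf-+ false x y = refl

flipIf-zero : ∀ c → flipIf c (+ 0) ≡ + 0
flipIf-zero true  = refl
flipIf-zero false = refl

wordSign-cons : ∀ a b w → wordSign (a ∷ b ∷ w) ≡ flipIf (isPeak a b) (wordSign (b ∷ w))
wordSign-cons a b w with isPeak a b
... | true  = signℤ-suc (+ peakCount (b ∷ w))
... | false = refl

prefixed : Letter → List (List Letter) → ℤ
prefixed a ws = signedCount (map (a ∷_) ws)

prefixed-++ : ∀ a xs ys → prefixed a (xs ++ ys) ≡ prefixed a xs + prefixed a ys
prefixed-++ a xs ys = trans (cong signedCount (map-++ (a ∷_) xs ys))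
                            (signedCount-++ (map (a ∷_) xs) (map (a ∷_) ys))

prefixed-cons : ∀ a b ws → prefixed a (map (b ∷_) ws) ≡ flipIf (isPeak a b) (prefixed b ws)
prefixed-cons a b []       = sym (flipIf-zero (isPeak a b))
prefixed-cons a b (w ∷ ws) = begin
    wordSign (a ∷ b ∷ w) + prefixed a (map (b ∷_) ws)
  ≡⟨ cong₂ _+_ (wordSign-cons a b w) (prefixed-cons a b ws) ⟩
    flipIf (isPeak a b) (wordSign (b ∷ w)) + flipIf (isPeak a b) (prefixed b ws)
  ≡⟨ sym (flipIf-+ (isPeak a b) (wordSign (b ∷ w)) (prefixed b ws)) ⟩
    flipIf (isPeak a b) (prefixed b (w ∷ ws))
  ∎

prefixed-inert : ∀ a → (∀ b → isPeak a b ≡ false) → ∀ ws → prefixed a ws ≡ signedCount ws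
prefixed-inert a inert []       = refl
prefixed-inert a inert (w ∷ ws) = cong₂ _+_ (inert-sign w) (prefixed-inert a inert ws)
  where
  inert-sign : ∀ w → wordSign (a ∷ w) ≡ wordSign w
  inert-sign []      = refl
  inert-sign (b ∷ w) = trans (wordSign-cons a b w) (cong (λ c → flipIf c (wordSign (b ∷ w))) (inert b))

prefixed-shuffle : ∀ c x y xs ys → prefixed c (shuffles (x ∷ xs) (y ∷ ys))
  ≡ flipIf (isPeak c x) (prefixed x (shuffles xs (y ∷ ys)))
    + flipIf (isPeak c y) (prefixed y (shuffles (x ∷ xs) ys))
prefixed-shuffle c x y xs ys =
  trans (prefixed-++ c (map (x ∷_) (shuffles xs (y ∷ ys))) (map (y ∷_) (shuffles (x ∷ xs) ys)))
        (cong₂ _+_ (prefixed-cons c x (shuffles xs (y ∷ ys))) (prefixed-cons c y (shuffles (x ∷ xs) ys)))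

sh : List VLetter → List HLetter → List (List Letter)
sh V H = shuffles (map vl V) (map hl H)

F : List VLetter → List HLetter → ℤ
F V H = signedCount (sh V H)

crossing : VLetter → HLetter → Bool
crossing a b = isPeak (vl a) (hl b) ∨ isPeak (hl b) (vl a)

up-before-vertical : ∀ x → isPeak up (vl x) ≡ false
up-before-vertical vup   = refl
up-before-vertical vdown = refl

right-before-horizontal : ∀ y → isPeak right (hl y) ≡ false
right-before-horizontal hright = refl
right-before-horizontal hleft  = refl

peakCount-vertical : ∀ V → peakCount (map vl V) ≡ 0
peakCount-vertical []              = refl
peakCount-vertical (x ∷ [])        = refl
peakCount-vertical (vup ∷ vup ∷ V)   = peakCount-vertical (vup ∷ V)
peakCount-vertical (vup ∷ vdown ∷ V) = peakCount-vertical (vdown ∷ V)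
peakCount-vertical (vdown ∷ y ∷ V)   = peakCount-vertical (y ∷ V)

peakCount-horizontal : ∀ H → peakCount (map hl H) ≡ 0
peakCount-horizontal []                    = refl
peakCount-horizontal (y ∷ [])              = refl
peakCount-horizontal (hright ∷ hright ∷ H) = peakCount-horizontal (hright ∷ H)
peakCount-horizontal (hright ∷ hleft ∷ H)  = peakCount-horizontal (hleft ∷ H)
peakCount-horizontal (hleft ∷ y ∷ H)       = peakCount-horizontal (y ∷ H)

F-nilˡ : ∀ H → F [] H ≡ + 1
F-nilˡ H = cong (λ n → signℤ (+ n) + + 0) (peakCount-horizontal H)

F-nilʳ : ∀ V → F V [] ≡ + 1
F-nilʳ []      = refl
F-nilʳ (x ∷ V) = cong (λ n → signℤ (+ n) + + 0) (peakCount-vertical (x ∷ V))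

F-cons : ∀ a b V H → F (a ∷ V) (b ∷ H) ≡ prefixed (vl a) (sh V (b ∷ H)) + prefixed (hl b) (sh (a ∷ V) H)
F-cons a b V H = signedCount-++ (map (vl a ∷_) (sh V (b ∷ H))) (map (hl b ∷_) (sh (a ∷ V) H))

-- A leading ↑ flips exactly the shuffles that continue with ←.
prefixed-up : ∀ V b H → prefixed up (sh V (b ∷ H)) ≡ adjust (crossing vup b) (F V (b ∷ H)) (F V H)
prefixed-up [] hright H = refl
prefixed-up [] hleft  H = begin
    signℤ (+ suc (peakCount (map hl (hleft ∷ H)))) + + 0
  ≡⟨ cong (λ n → signℤ (+ suc n) + + 0) (peakCount-horizontal (hleft ∷ H)) ⟩
    + 1 - (+ 1 + + 1)
  ≡⟨ sym (cong₂ (λ s z → s - (z + z)) (F-nilˡ (hleft ∷ H)) (F-nilˡ H)) ⟩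
    F [] (hleft ∷ H) - (F [] H + F [] H)
  ∎
prefixed-up (x ∷ V) b H
  rewrite prefixed-shuffle up (vl x) (hl b) (map vl V) (map hl H) | up-before-vertical x
  with b
... | hright = sym (F-cons x hright V H)
... | hleft  = begin
    X + - Y
  ≡⟨ rearrange X Y ⟩
    X + Y - (Y + Y)
  ≡⟨ cong₂ (λ s z → s - (z + z)) (sym (F-cons x hleft V H))
           (prefixed-inert left (λ _ → refl) (sh (x ∷ V) H)) ⟩
    F (x ∷ V) (hleft ∷ H) - (F (x ∷ V) H + F (x ∷ V) H)
  ∎
  where
  X = prefixed (vl x) (sh V (hleft ∷ H))
  Y = prefixed left (sh (x ∷ V) H)
  rearrange : ∀ x y → x + - y ≡ x + y - (y + y)
  rearrange = solve-∀

-- A leading → flips exactly the shuffles that continue with ↓.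
prefixed-right : ∀ a V H → prefixed right (sh (a ∷ V) H) ≡ adjust (crossing a hright) (F (a ∷ V) H) (F V H)
prefixed-right vup   V [] = refl
prefixed-right vdown V [] = begin
    signℤ (+ suc (peakCount (map vl (vdown ∷ V)))) + + 0
  ≡⟨ cong (λ n → signℤ (+ suc n) + + 0) (peakCount-vertical (vdown ∷ V)) ⟩
    + 1 - (+ 1 + + 1)
  ≡⟨ sym (cong₂ (λ s z → s - (z + z)) (F-nilʳ (vdown ∷ V)) (F-nilʳ V)) ⟩
    F (vdown ∷ V) [] - (F V [] + F V [])
  ∎
prefixed-right a V (y ∷ H)
  rewrite prefixed-shuffle right (vl a) (hl y) (map vl V) (map hl H) | right-before-horizontal y
  with a
... | vup   = sym (F-cons vup y V H)
... | vdown = begin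
    - X + Y
  ≡⟨ rearrange X Y ⟩
    X + Y - (X + X)
  ≡⟨ cong₂ (λ s z → s - (z + z)) (sym (F-cons vdown y V H))
           (prefixed-inert down (λ _ → refl) (sh V (y ∷ H))) ⟩
    F (vdown ∷ V) (y ∷ H) - (F V (y ∷ H) + F V (y ∷ H))
  ∎
  where
  X = prefixed down (sh V (y ∷ H))
  Y = prefixed (hl y) (sh (vdown ∷ V) H)
  rearrange : ∀ x y → - x + y ≡ x + y - (x + x)
  rearrange = solve-∀

F-step : ∀ a b V H → F (a ∷ V) (b ∷ H) ≡ adjust (crossing a b) (F V (b ∷ H) + F (a ∷ V) H) (F V H)
F-step vup hright V H =
  trans (F-cons vup hright V H) (cong₂ _+_ (prefixed-up V hright H) (prefixed-right vup V H))
F-step vup hleft V H =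
  trans (F-cons vup hleft V H)
  (trans (cong₂ _+_ (prefixed-up V hleft H) (prefixed-inert left (λ _ → refl) (sh (vup ∷ V) H)))
         (adjust-+ˡ true (F V (hleft ∷ H)) (F (vup ∷ V) H) (F V H)))
F-step vdown hleft V H =
  trans (F-cons vdown hleft V H)
        (cong₂ _+_ (prefixed-inert down (λ _ → refl) (sh V (hleft ∷ H)))
                   (prefixed-inert left (λ _ → refl) (sh (vdown ∷ V) H)))
F-step vdown hright V H =
  trans (F-cons vdown hright V H)
  (trans (cong₂ _+_ (prefixed-inert down (λ _ → refl) (sh V (hright ∷ H))) (prefixed-right vdown V H))
         (adjust-+ʳ true (F V (hright ∷ H)) (F (vdown ∷ V) H) (F V H)))

-- The binomial sum at the letter counts obeys the same recursion

R : List VLetter → List HLetter → ℤ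
R V H = rhs (countV vup V) (countV vdown V) (countH hright H) (countH hleft H)

R-step : ∀ a b V H → R (a ∷ V) (b ∷ H) ≡ adjust (crossing a b) (R V (b ∷ H) + R (a ∷ V) H) (R V H)
R-step vup   hright V H = rhs-up-right   (countV vup V) (countV vdown V) (countH hright H) (countH hleft H)
R-step vup   hleft  V H = rhs-up-left    (countV vup V) (countV vdown V) (countH hright H) (countH hleft H)
R-step vdown hleft  V H = rhs-down-left  (countV vup V) (countV vdown V) (countH hright H) (countH hleft H)
R-step vdown hright V H = rhs-down-right (countV vup V) (countV vdown V) (countH hright H) (countH hleft H)

corollary2p17 : (V : List VLetter) (H : List HLetter) →
    signedCount (shuffles (map vl V) (map hl H))
      ≡ rhs (countV vup V) (countV vdown V) (countH hright H) (countH hleft H)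
corollary2p17 []      H  = trans (F-nilˡ H) (sym (rhs-without-vertical (countH hright H) (countH hleft H)))
corollary2p17 (a ∷ V) [] = trans (F-nilʳ (a ∷ V)) (sym (rhs-without-horizontal (countV vup (a ∷ V)) (countV vdown (a ∷ V))))
corollary2p17 (a ∷ V) (b ∷ H) = begin
    F (a ∷ V) (b ∷ H)
  ≡⟨ F-step a b V H ⟩
    adjust (crossing a b) (F V (b ∷ H) + F (a ∷ V) H) (F V H)
  ≡⟨ cong₂ (adjust (crossing a b))
       (cong₂ _+_ (corollary2p17 V (b ∷ H)) (corollary2p17 (a ∷ V) H))
       (corollary2p17 V H) ⟩
    adjust (crossing a b) (R V (b ∷ H) + R (a ∷ V) H) (R V H)
  ≡⟨ sym (R-step a b V H) ⟩
    R (a ∷ V) (b ∷ H)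
  ∎
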